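{- For positive integers $k<n$, $\alpha(\Gamma_{k,n})\ge k!\,(n-k)!$ and $\chi(\Gamma_{k,n})\le\binom{n}{k}$.
   Context: $S_n$ is the symmetric group on $[n]=\{1,\dots,n\}$. For $\sigma\in S_n$, $\sigma_{(k)}$ denotes the induced permutation of the set of $k$-element subsets of $[n]$, $\sigma_{(k)}(\{a_1,\dots,a_k\})=\{\sigma(a_1),\dots,\sigma(a_k)\}$; $\sigma$ is a $k$-derangement if $\sigma_{(k)}$ fixes no $k$-element subset. Let $\mathcal{D}_{k,n}$ be the set of $k$-derangements in $S_n$. The $k$-derangement graph $\Gamma_{k,n}$ is the Cayley graph $\Gamma(S_n,\mathcal{D}_{k,n})$: vertices are the elements of $S_n$, and $u,v$ are adjacent iff $su=v$ for some $s\in\mathcal{D}_{k,n}$. $\alpha(G)$ is the independence number and $\chi(G)$ the chromatic number of $G$. -}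

module Defs where

open import Data.Nat using (ℕ)
open import Data.Fin using (Fin)
open import Data.Fin.Subset using (Subset; _∈_; ∣_∣)
open import Data.Fin.Permutation using (Permutation′; _⟨$⟩ʳ_)
open import Data.Product using (Σ; _×_; ∃)
open import Relation.Binary.PropositionalEquality using (_≡_; _≢_)
open import Relation.Nullary using (¬_)

FixesSubset : {n : ℕ} → Permutation′ n → Subset n → Set
FixesSubset σ S =
  (∀ a → a ∈ S → (σ ⟨$⟩ʳ a) ∈ S) ×
  (∀ b → b ∈ S → Σ (Fin _) λ a → a ∈ S × (σ ⟨$⟩ʳ a) ≡ b)

IsKDerangement : (k : ℕ) {n : ℕ} → Permutation′ n → Set
IsKDerangement k σ = ∀ S → ∣ S ∣ ≡ k → ¬ FixesSubset σ S

-- Adjacency in Γ_{k,n} = Cayley graph Γ(S_n, D_{k,n}):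
-- u ~ v iff s u = v for some k-derangement s (equality of permutations
-- is pointwise).
Adjacent : (k : ℕ) {n : ℕ} → Permutation′ n → Permutation′ n → Set
Adjacent k u v =
  Σ (Permutation′ _) λ s → IsKDerangement k s × (∀ x → s ⟨$⟩ʳ (u ⟨$⟩ʳ x) ≡ v ⟨$⟩ʳ x)

DistinctPerm : {n : ℕ} → Permutation′ n → Permutation′ n → Set
DistinctPerm u v = ∃ λ x → u ⟨$⟩ʳ x ≢ v ⟨$⟩ʳ x

IndependenceNumberAtLeast : (k n m : ℕ) → Set
IndependenceNumberAtLeast k n m =
  Σ (Fin m → Permutation′ n) λ f →
    (∀ i j → i ≢ j → DistinctPerm (f i) (f j)) ×
    (∀ i j → ¬ Adjacent k (f i) (f j))

ChromaticNumberAtMost : (k n m : ℕ) → Set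
ChromaticNumberAtMost k n m =
  Σ (Permutation′ n → Fin m) λ c →
    ∀ u v → Adjacent k u v → c u ≢ c v

module Submission where

-- If S is a k-subset of [n] and the
-- permutations u, v have the same preimage u⁻¹(S) = v⁻¹(S), then s = v u⁻¹
-- maps S onto S, so s is not a k-derangement and u, v are not adjacent
-- (samePreimage⇒nonAdjacent).
--
--  * Colouring: colour u by the rank of the k-subset u⁻¹(S) among all
--    (n C k) k-subsets of [n].  Equal colours mean equal preimages, hence
--    non-adjacency.  The ranking is the usual lexicographic one (rank).
--  * Independent set: all permutations stabilising S have preimage S, so any
--    family of distinct stabilisers is independent.  For S = {0,…,k-1} in
--    [k + m] the block permutations π ⊕ ρ (π ∈ S_k, ρ ∈ S_m) give k! m!
--    distinct stabilisers, using an explicit enumeration Fin (k !) → S_k.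

open import Defs
open import Data.Nat using (ℕ; zero; suc; _+_; _*_; _∸_; _<_; _!; z≤n; s≤s)
import Data.Nat.Properties as ℕ
open import Data.Nat.Combinatorics using (_C_; nCk+nC[k+1]≡[n+1]C[k+1])
open import Data.Bool using (Bool; true; false)
open import Data.Fin using (Fin; zero; suc; toℕ; fromℕ<; splitAt; join; remQuot)
open import Data.Fin.Properties as Fin using (+↔⊎; *↔×; splitAt-join; ¬∀⟶∃¬)
open import Data.Fin.Permutation using (Permutation′; _⟨$⟩ʳ_; _⟨$⟩ˡ_; _≈_; inverseʳ; lift₀; transpose; _∘ₚ_)
import Data.Fin.Permutation as Perm
open import Data.Fin.Subset using (Subset; _∈_; ∣_∣; ⊤; ⊥)
open import Data.Fin.Subset.Properties using (∣⊤∣≡n; ∣⊥∣≡0)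
open import Data.Vec using ([]; _∷_; _++_; lookup; tabulate)
import Data.Vec.Properties as Vec
open import Data.Product using (Σ; _×_; _,_; proj₁; proj₂)
open import Data.Product.Properties using (×-≡,≡→≡)
open import Data.Sum using (_⊎_; inj₁; inj₂; [_,_]′)
import Data.Sum as Sum
open import Data.Sum.Properties using (inj₁-injective; inj₂-injective)
open import Data.Sum.Function.Propositional using (_⊎-↔_)
open import Function.Bundles using (Injection)
open import Function.Properties.Inverse using (↔-trans; ↔-sym; ↔⇒↣)
open import Data.Empty using (⊥-elim)
open import Relation.Nullary using (¬_)
open import Relation.Binary.PropositionalEquality
open import Algebra.Properties.CommutativeMonoid.Sum ℕ.+-0-commutativeMonoid using (sum; sum-permute)

preservesMembership⇒fixes : ∀ {n} (s : Permutation′ n) (S : Subset n) →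
  (∀ a → lookup S (s ⟨$⟩ʳ a) ≡ lookup S a) → FixesSubset s S
preservesMembership⇒fixes s S pres = into , onto
  where
  into : ∀ a → a ∈ S → (s ⟨$⟩ʳ a) ∈ S
  into a a∈S = Vec.lookup⇒[]= (s ⟨$⟩ʳ a) S (trans (pres a) (Vec.[]=⇒lookup a∈S))
  onto : ∀ b → b ∈ S → Σ (Fin _) λ a → a ∈ S × (s ⟨$⟩ʳ a) ≡ b
  onto b b∈S = s ⟨$⟩ˡ b , Vec.lookup⇒[]= (s ⟨$⟩ˡ b) S preimage∈S , inverseʳ s
    where
    preimage∈S : lookup S (s ⟨$⟩ˡ b) ≡ true
    preimage∈S = trans (sym (pres (s ⟨$⟩ˡ b)))
                   (trans (cong (lookup S) (inverseʳ s)) (Vec.[]=⇒lookup b∈S))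

SamePreimage : ∀ {n} → Subset n → Permutation′ n → Permutation′ n → Set
SamePreimage S u v = ∀ x → lookup S (u ⟨$⟩ʳ x) ≡ lookup S (v ⟨$⟩ʳ x)

-- The key lemma: permutations with the same preimage of a k-subset are not
-- adjacent, since the connecting permutation s = v u⁻¹ fixes that k-subset.
samePreimage⇒nonAdjacent : ∀ {k n} (S : Subset n) → ∣ S ∣ ≡ k →
  ∀ u v → SamePreimage S u v → ¬ Adjacent k u v
samePreimage⇒nonAdjacent S ∣S∣≡k u v same (s , derangement , su≡v) =
  derangement S ∣S∣≡k (preservesMembership⇒fixes s S preserves)
  where
  open ≡-Reasoning
  preserves : ∀ a → lookup S (s ⟨$⟩ʳ a) ≡ lookup S a
  preserves a = begin
    lookup S (s ⟨$⟩ʳ a)                  ≡⟨ cong (λ y → lookup S (s ⟨$⟩ʳ y)) (inverseʳ u) ⟨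
    lookup S (s ⟨$⟩ʳ (u ⟨$⟩ʳ (u ⟨$⟩ˡ a))) ≡⟨ cong (lookup S) (su≡v (u ⟨$⟩ˡ a)) ⟩
    lookup S (v ⟨$⟩ʳ (u ⟨$⟩ˡ a))          ≡⟨ same (u ⟨$⟩ˡ a) ⟨
    lookup S (u ⟨$⟩ʳ (u ⟨$⟩ˡ a))          ≡⟨ cong (lookup S) (inverseʳ u) ⟩
    lookup S a                           ∎

preimage : ∀ {n} → Permutation′ n → Subset n → Subset n
preimage u S = tabulate (λ x → lookup S (u ⟨$⟩ʳ x))

preimage-injective : ∀ {n} (S : Subset n) u v → preimage u S ≡ preimage v S → SamePreimage S u v
preimage-injective S u v eq x =
  trans (sym (Vec.lookup∘tabulate _ x))
        (trans (cong (λ T → lookup T x) eq) (Vec.lookup∘tabulate _ x))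

indicator : Bool → ℕ
indicator true  = 1
indicator false = 0

∣tabulate∣ : ∀ {n} (f : Fin n → Bool) → ∣ tabulate f ∣ ≡ sum (λ i → indicator (f i))
∣tabulate∣ {zero}  f = refl
∣tabulate∣ {suc n} f with f zero
... | true  = cong suc (∣tabulate∣ (λ i → f (suc i)))
... | false = ∣tabulate∣ (λ i → f (suc i))

∣preimage∣ : ∀ {n} (u : Permutation′ n) (S : Subset n) → ∣ preimage u S ∣ ≡ ∣ S ∣
∣preimage∣ u S = begin
  ∣ preimage u S ∣                      ≡⟨ ∣tabulate∣ (λ x → lookup S (u ⟨$⟩ʳ x)) ⟩
  sum (λ x → indicator (lookup S (u ⟨$⟩ʳ x))) ≡⟨ sum-permute (λ y → indicator (lookup S y)) u ⟨
  sum (λ y → indicator (lookup S y))    ≡⟨ ∣tabulate∣ (lookup S) ⟨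
  ∣ tabulate (lookup S) ∣               ≡⟨ cong ∣_∣ (Vec.tabulate∘lookup S) ⟩
  ∣ S ∣                                 ∎
  where open ≡-Reasoning

-- Lexicographic rank of a k-subset of [n]: the k-subsets of [1+n] containing
-- the first point come first (there are n C (k-1) of them), then the others.
-- The clause for (true ∷ v) with k = 0 only concerns subsets of the wrong size.
rank : ∀ {n} → Subset n → ℕ → ℕ
rank []          _       = 0
rank (true ∷ v)  zero    = 0
rank (true ∷ v)  (suc k) = rank v k
rank (false ∷ v) zero    = rank v zero
rank {suc n} (false ∷ v) (suc k) = n C k + rank v (suc k)

rank< : ∀ {n} (v : Subset n) k → ∣ v ∣ ≡ k → rank v k < n C k
rank< []          zero    _  = s≤s z≤n
rank< (false ∷ v) zero    eq = rank< v zero eq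
rank< {suc n} (true ∷ v) (suc k) eq =
  subst (rank v k <_) (nCk+nC[k+1]≡[n+1]C[k+1] n k)
    (ℕ.<-≤-trans (rank< v k (ℕ.suc-injective eq)) (ℕ.m≤m+n (n C k) (n C suc k)))
rank< {suc n} (false ∷ v) (suc k) eq =
  subst (n C k + rank v (suc k) <_) (nCk+nC[k+1]≡[n+1]C[k+1] n k)
    (ℕ.+-monoʳ-< (n C k) (rank< v (suc k) eq))

rank-first<rank-rest : ∀ {n} (v w : Subset n) k → ∣ v ∣ ≡ k →
  rank (true ∷ v) (suc k) < rank (false ∷ w) (suc k)
rank-first<rank-rest {n} v w k eq =
  ℕ.<-≤-trans (rank< v k eq) (ℕ.m≤m+n (n C k) (rank w (suc k)))

rank-injective : ∀ {n} (v w : Subset n) k → ∣ v ∣ ≡ k → ∣ w ∣ ≡ k →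
  rank v k ≡ rank w k → v ≡ w
rank-injective [] [] k _ _ _ = refl
rank-injective (false ∷ v) (false ∷ w) zero ev ew eq =
  cong (false ∷_) (rank-injective v w zero ev ew eq)
rank-injective (true ∷ v) (true ∷ w) (suc k) ev ew eq =
  cong (true ∷_) (rank-injective v w k (ℕ.suc-injective ev) (ℕ.suc-injective ew) eq)
rank-injective {suc n} (false ∷ v) (false ∷ w) (suc k) ev ew eq =
  cong (false ∷_) (rank-injective v w (suc k) ev ew (ℕ.+-cancelˡ-≡ (n C k) _ _ eq))
rank-injective (true ∷ v) (false ∷ w) (suc k) ev _ eq =
  ⊥-elim (ℕ.<-irrefl eq (rank-first<rank-rest v w k (ℕ.suc-injective ev)))
rank-injective (false ∷ v) (true ∷ w) (suc k) _ ew eq =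
  ⊥-elim (ℕ.<-irrefl (sym eq) (rank-first<rank-rest w v k (ℕ.suc-injective ew)))

preimageColouring : ∀ {k n} (S : Subset n) → ∣ S ∣ ≡ k → ChromaticNumberAtMost k n (n C k)
preimageColouring {k} S ∣S∣≡k = colour , proper
  where
  size : ∀ u → ∣ preimage u S ∣ ≡ k
  size u = trans (∣preimage∣ u S) ∣S∣≡k
  colour : Permutation′ _ → Fin (_ C k)
  colour u = fromℕ< (rank< (preimage u S) k (size u))
  proper : ∀ u v → Adjacent k u v → colour u ≢ colour v
  proper u v adjacent same = samePreimage⇒nonAdjacent S ∣S∣≡k u v samePreimage adjacent
    where
    sameRank : rank (preimage u S) k ≡ rank (preimage v S) k
    sameRank = trans (sym (Fin.toℕ-fromℕ< _)) (trans (cong toℕ same) (Fin.toℕ-fromℕ< _))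
    samePreimage : SamePreimage S u v
    samePreimage = preimage-injective S u v
      (rank-injective _ _ k (size u) (size v) sameRank)

Stabilises : ∀ {n} → Subset n → Permutation′ n → Set
Stabilises S u = ∀ x → lookup S (u ⟨$⟩ʳ x) ≡ lookup S x

-- Distinct stabilisers of a k-subset form an independent set, since any two
-- of them have the same preimage S.
stabilisersIndependent : ∀ {k n m} (S : Subset n) → ∣ S ∣ ≡ k →
  (f : Fin m → Permutation′ n) → (∀ i j → f i ≈ f j → i ≡ j) →
  (∀ i → Stabilises S (f i)) → IndependenceNumberAtLeast k n m
stabilisersIndependent {n = n} S ∣S∣≡k f f-injective stabilises = f , distinct , independent
  where
  distinct : ∀ i j → i ≢ j → DistinctPerm (f i) (f j)
  distinct i j i≢j = ¬∀⟶∃¬ n _ (λ x → f i ⟨$⟩ʳ x Fin.≟ f j ⟨$⟩ʳ x)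
                       (λ fi≈fj → i≢j (f-injective i j fi≈fj))
  independent : ∀ i j → ¬ Adjacent _ (f i) (f j)
  independent i j = samePreimage⇒nonAdjacent S ∣S∣≡k (f i) (f j)
    (λ x → trans (stabilises i x) (sym (stabilises j x)))

remQuot-injective : ∀ {a} b {c d : Fin (a * b)} → remQuot {a} b c ≡ remQuot b d → c ≡ d
remQuot-injective {a} b = Injection.injective (↔⇒↣ (*↔× {a} {b}))

-- An enumeration of S_k: the index of a permutation of [1+k] encodes its
-- value at 0 and (recursively) the induced permutation of the rest.
enumerate : ∀ k → Fin (k !) → Permutation′ k
enumerate zero    _ = Perm.id
enumerate (suc k) c =
  lift₀ (enumerate k (proj₂ (remQuot {suc k} (k !) c))) ∘ₚ transpose zero (proj₁ (remQuot {suc k} (k !) c))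

-- The permutation lift₀ p followed by the transposition (0 i) sends 0 to i
-- and determines p, so both i and p can be read off.
lift₀-transpose-injective : ∀ {k} (i i′ : Fin (suc k)) (p p′ : Permutation′ k) →
  lift₀ p ∘ₚ transpose zero i ≈ lift₀ p′ ∘ₚ transpose zero i′ → i ≡ i′ × p ≈ p′
lift₀-transpose-injective i i′ p p′ eq with eq zero
... | refl = refl , λ x → Fin.suc-injective (Injection.injective (↔⇒↣ (transpose zero i)) (eq (suc x)))

enumerate-injective : ∀ k (c d : Fin (k !)) → enumerate k c ≈ enumerate k d → c ≡ d
enumerate-injective zero    zero zero _ = refl
enumerate-injective (suc k) c d eq
  with lift₀-transpose-injective _ _ _ _ eq
... | sameValue , sameRest =
  remQuot-injective {suc k} (k !)
    (×-≡,≡→≡ (sameValue , enumerate-injective k _ _ sameRest))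

block : ∀ {k m} → Permutation′ k → Permutation′ m → Permutation′ (k + m)
block π ρ = ↔-trans +↔⊎ (↔-trans (π ⊎-↔ ρ) (↔-sym +↔⊎))

splitAt-block : ∀ {k m} (π : Permutation′ k) (ρ : Permutation′ m) x →
  splitAt k (block π ρ ⟨$⟩ʳ x) ≡ Sum.map (π ⟨$⟩ʳ_) (ρ ⟨$⟩ʳ_) (splitAt k x)
splitAt-block {k} {m} π ρ x = splitAt-join k m _

block-injective : ∀ {k m} (π π′ : Permutation′ k) (ρ ρ′ : Permutation′ m) →
  block π ρ ≈ block π′ ρ′ → π ≈ π′ × ρ ≈ ρ′
block-injective {k} {m} π π′ ρ ρ′ eq =
  (λ x → inj₁-injective (agreeOnSummands (inj₁ x))) ,
  (λ x → inj₂-injective (agreeOnSummands (inj₂ x)))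
  where
  mapπρ mapπ′ρ′ : Fin k ⊎ Fin m → Fin k ⊎ Fin m
  mapπρ = Sum.map (π ⟨$⟩ʳ_) (ρ ⟨$⟩ʳ_)
  mapπ′ρ′ = Sum.map (π′ ⟨$⟩ʳ_) (ρ′ ⟨$⟩ʳ_)
  agreeAfterSplit : ∀ x → mapπρ (splitAt k x) ≡ mapπ′ρ′ (splitAt k x)
  agreeAfterSplit x =
    trans (sym (splitAt-block π ρ x)) (trans (cong (splitAt k) (eq x)) (splitAt-block π′ ρ′ x))
  agreeOnSummands : ∀ s → mapπρ s ≡ mapπ′ρ′ s
  agreeOnSummands s =
    subst (λ t → mapπρ t ≡ mapπ′ρ′ t) (splitAt-join k m s) (agreeAfterSplit (join k m s))

initialSegment : ∀ k m → Subset (k + m)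
initialSegment k m = ⊤ {k} ++ ⊥ {m}

∣++∣ : ∀ {a b} (p : Subset a) (q : Subset b) → ∣ p ++ q ∣ ≡ ∣ p ∣ + ∣ q ∣
∣++∣ []          q = refl
∣++∣ (true ∷ p)  q = cong suc (∣++∣ p q)
∣++∣ (false ∷ p) q = ∣++∣ p q

∣initialSegment∣ : ∀ k m → ∣ initialSegment k m ∣ ≡ k
∣initialSegment∣ k m = trans (∣++∣ (⊤ {k}) (⊥ {m}))
  (trans (cong₂ _+_ (∣⊤∣≡n k) (∣⊥∣≡0 m)) (ℕ.+-identityʳ k))

-- Block permutations preserve the two summands, hence the initial segment.
block-stabilises : ∀ {k m} (π : Permutation′ k) (ρ : Permutation′ m) →
  Stabilises (initialSegment k m) (block π ρ)
block-stabilises {k} {m} π ρ x = begin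
  lookup (initialSegment k m) (block π ρ ⟨$⟩ʳ x)   ≡⟨ Vec.lookup-splitAt k (⊤ {k}) (⊥ {m}) _ ⟩
  side (splitAt k (block π ρ ⟨$⟩ʳ x))              ≡⟨ cong side (splitAt-block π ρ x) ⟩
  side (Sum.map (π ⟨$⟩ʳ_) (ρ ⟨$⟩ʳ_) (splitAt k x)) ≡⟨ sideInvariant (splitAt k x) ⟩
  side (splitAt k x)                               ≡⟨ Vec.lookup-splitAt k (⊤ {k}) (⊥ {m}) x ⟨
  lookup (initialSegment k m) x                    ∎
  where
  open ≡-Reasoning
  side : Fin k ⊎ Fin m → Bool
  side = [ lookup ⊤ , lookup ⊥ ]′
  sideInvariant : ∀ s → side (Sum.map (π ⟨$⟩ʳ_) (ρ ⟨$⟩ʳ_) s) ≡ side s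
  sideInvariant (inj₁ a) = trans (Vec.lookup-replicate (π ⟨$⟩ʳ a) true) (sym (Vec.lookup-replicate a true))
  sideInvariant (inj₂ b) = trans (Vec.lookup-replicate (ρ ⟨$⟩ʳ b) false) (sym (Vec.lookup-replicate b false))

leftFactor : ∀ k m → Fin (k ! * m !) → Permutation′ k
leftFactor k m c = enumerate k (proj₁ (remQuot {k !} (m !) c))

rightFactor : ∀ k m → Fin (k ! * m !) → Permutation′ m
rightFactor k m c = enumerate m (proj₂ (remQuot {k !} (m !) c))

blocks : ∀ k m → Fin (k ! * m !) → Permutation′ (k + m)
blocks k m c = block (leftFactor k m c) (rightFactor k m c)

blocks-injective : ∀ k m (c d : Fin (k ! * m !)) → blocks k m c ≈ blocks k m d → c ≡ d
blocks-injective k m c d eq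
  with block-injective (leftFactor k m c) (leftFactor k m d) (rightFactor k m c) (rightFactor k m d) eq
... | sameLeft , sameRight = remQuot-injective {k !} (m !)
  (×-≡,≡→≡ (enumerate-injective k _ _ sameLeft , enumerate-injective m _ _ sameRight))

blocks-stabilise : ∀ k m c → Stabilises (initialSegment k m) (blocks k m c)
blocks-stabilise k m c = block-stabilises (leftFactor k m c) (rightFactor k m c)

theorem4 : (k n : ℕ) → 0 < k → k < n →
    IndependenceNumberAtLeast k n ((k !) * ((n ∸ k) !)) × ChromaticNumberAtMost k n (n C k)
theorem4 k n _ k<n =
  subst (λ N → IndependenceNumberAtLeast k N (k ! * m !) × ChromaticNumberAtMost k N (N C k))
    (ℕ.m+[n∸m]≡n (ℕ.<⇒≤ k<n))
    (independent , colouring)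
  where
  m : ℕ
  m = n ∸ k
  S : Subset (k + m)
  S = initialSegment k m
  independent : IndependenceNumberAtLeast k (k + m) (k ! * m !)
  independent = stabilisersIndependent S (∣initialSegment∣ k m) (blocks k m)
    (blocks-injective k m) (blocks-stabilise k m)
  colouring : ChromaticNumberAtMost k (k + m) ((k + m) C k)
  colouring = preimageColouring S (∣initialSegment∣ k m)
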